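{- Let $R$ be an associative ring with unity and let $K$ be a class of left $R$-modules closed under finite direct sums, pure submodules and isomorphisms. The following are equivalent: (1) $K$ is closed under pushouts of pure embeddings in $R$-Mod, i.e., if $M,N_1,N_2\in K$, $f_1:M\to N_1$ and $f_2:M\to N_2$ are pure embeddings and $P$ is the pushout of $(f_1,f_2)$ in the category of left $R$-modules, then $P\in K$. (2) $K$ is closed under pure epimorphic images.
   Context: A pure embedding is an injective homomorphism whose image is a pure submodule (a submodule in which every finite tuple has the same pp-type as in the ambient module). A pure epimorphism is a surjective homomorphism whose kernel is a pure submodule. The pushout of $f_1:M\to N_1$, $f_2:M\to N_2$ in $R$-Mod is $(N_1\oplus N_2)/\{(f_1(m),-f_2(m)):m\in M\}$. -}

module Defs where

open import Level using (Level; _⊔_)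
open import Data.Nat using (ℕ; zero; suc)
open import Data.Fin using (Fin; zero; suc)
open import Data.Product using (Σ; ∃; _×_; _,_)
open import Function using (_∘_)
open import Function.Bundles using (_⇔_)
open import Function.Definitions using (Injective)
open import Algebra.Bundles using (Ring)
open import Algebra.Module.Bundles using (LeftModule)
open import Algebra.Module.Morphism.Structures using (module LeftModuleMorphisms)
import Algebra.Module.Construct.DirectProduct as DP

module _ {r ℓr : Level} {R : Ring r ℓr} where
  private module R = Ring R

  Σᴹ : ∀ {m ℓm} (M : LeftModule R m ℓm) {n : ℕ} → (Fin n → LeftModule.Carrierᴹ M) → LeftModule.Carrierᴹ M
  Σᴹ M {zero} x = LeftModule.0ᴹ M
  Σᴹ M {suc n} x = LeftModule._+ᴹ_ M (x zero) (Σᴹ M (x ∘ suc))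

  lin : ∀ {m ℓm} (M : LeftModule R m ℓm) {n : ℕ} → (Fin n → R.Carrier) → (Fin n → LeftModule.Carrierᴹ M) → LeftModule.Carrierᴹ M
  lin M a x = Σᴹ M (λ j → LeftModule._*ₗ_ M (a j) (x j))

  -- a pp-formula in n free variables:  ∃ y₁..y_m . ⋀_{i<k} (Σ_j A i j x_j + Σ_l B i l y_l = 0)
  record PP (n : ℕ) : Set r where
    field
      k m : ℕ
      A : Fin k → Fin n → R.Carrier
      B : Fin k → Fin m → R.Carrier

  SatIn : ∀ {m ℓm p} (M : LeftModule R m ℓm) (S : LeftModule.Carrierᴹ M → Set p) {n : ℕ}
          → PP n → (Fin n → LeftModule.Carrierᴹ M) → Set (m ⊔ ℓm ⊔ p)
  SatIn M S φ x = Σ (Fin (PP.m φ) → LeftModule.Carrierᴹ M) λ y →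
      ((l : Fin (PP.m φ)) → S (y l)) ×
      ((i : Fin (PP.k φ)) → LeftModule._≈ᴹ_ M
          (LeftModule._+ᴹ_ M (lin M (PP.A φ i) x) (lin M (PP.B φ i) y)) (LeftModule.0ᴹ M))

  Sat : ∀ {m ℓm} (M : LeftModule R m ℓm) {n : ℕ} → PP n → (Fin n → LeftModule.Carrierᴹ M) → Set (m ⊔ ℓm)
  Sat M φ x = Σ (Fin (PP.m φ) → LeftModule.Carrierᴹ M) λ y →
      ((i : Fin (PP.k φ)) → LeftModule._≈ᴹ_ M
          (LeftModule._+ᴹ_ M (lin M (PP.A φ i) x) (lin M (PP.B φ i) y)) (LeftModule.0ᴹ M))

  -- S (assumed to be a submodule) is pure in M: every finite tuple from S has the
  -- same pp-type in S as in M
  IsPureSubset : ∀ {m ℓm p} (M : LeftModule R m ℓm) (S : LeftModule.Carrierᴹ M → Set p) → Set (r ⊔ m ⊔ ℓm ⊔ p)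
  IsPureSubset M S = ∀ {n} (φ : PP n) (x : Fin n → LeftModule.Carrierᴹ M) →
      ((j : Fin n) → S (x j)) → (SatIn M S φ x ⇔ Sat M φ x)

  IsHom : ∀ {m₁ ℓ₁ m₂ ℓ₂} (M : LeftModule R m₁ ℓ₁) (N : LeftModule R m₂ ℓ₂)
          → (LeftModule.Carrierᴹ M → LeftModule.Carrierᴹ N) → Set (r ⊔ m₁ ⊔ ℓ₁ ⊔ ℓ₂)
  IsHom M N f = LeftModuleMorphisms.IsLeftModuleHomomorphism
                  (LeftModule.rawLeftModule M) (LeftModule.rawLeftModule N) f

  IsIso : ∀ {m₁ ℓ₁ m₂ ℓ₂} (M : LeftModule R m₁ ℓ₁) (N : LeftModule R m₂ ℓ₂)
          → (LeftModule.Carrierᴹ M → LeftModule.Carrierᴹ N) → Set (r ⊔ m₁ ⊔ m₂ ⊔ ℓ₁ ⊔ ℓ₂)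
  IsIso M N f = LeftModuleMorphisms.IsLeftModuleIsomorphism
                  (LeftModule.rawLeftModule M) (LeftModule.rawLeftModule N) f

  Image : ∀ {m₁ ℓ₁ m₂ ℓ₂} (M : LeftModule R m₁ ℓ₁) (N : LeftModule R m₂ ℓ₂)
          → (LeftModule.Carrierᴹ M → LeftModule.Carrierᴹ N) → LeftModule.Carrierᴹ N → Set (m₁ ⊔ ℓ₂)
  Image M N f y = ∃ λ x → LeftModule._≈ᴹ_ N (f x) y

  Kernel : ∀ {m₁ ℓ₁ m₂ ℓ₂} (M : LeftModule R m₁ ℓ₁) (N : LeftModule R m₂ ℓ₂)
           → (LeftModule.Carrierᴹ M → LeftModule.Carrierᴹ N) → LeftModule.Carrierᴹ M → Set ℓ₂
  Kernel M N f x = LeftModule._≈ᴹ_ N (f x) (LeftModule.0ᴹ N)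

  IsPureEmbedding : ∀ {m₁ ℓ₁ m₂ ℓ₂} (M : LeftModule R m₁ ℓ₁) (N : LeftModule R m₂ ℓ₂)
          → (LeftModule.Carrierᴹ M → LeftModule.Carrierᴹ N) → Set (r ⊔ m₁ ⊔ ℓ₁ ⊔ m₂ ⊔ ℓ₂)
  IsPureEmbedding M N f =
    IsHom M N f × Injective (LeftModule._≈ᴹ_ M) (LeftModule._≈ᴹ_ N) f × IsPureSubset N (Image M N f)

  IsPureEpi : ∀ {m₁ ℓ₁ m₂ ℓ₂} (M : LeftModule R m₁ ℓ₁) (N : LeftModule R m₂ ℓ₂)
          → (LeftModule.Carrierᴹ M → LeftModule.Carrierᴹ N) → Set (r ⊔ m₁ ⊔ ℓ₁ ⊔ m₂ ⊔ ℓ₂)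
  IsPureEpi M N f =
    IsHom M N f × (∀ y → Image M N f y) × IsPureSubset M (Kernel M N f)

  -- P (with g₁ : N₁ → P, g₂ : N₂ → P) is the pushout of f₁ : M → N₁, f₂ : M → N₂, i.e.
  -- the map N₁ ⊕ N₂ → P, (a , b) ↦ g₁ a + g₂ b is a surjective homomorphism with kernel
  -- exactly { (f₁ m , - f₂ m) : m ∈ M }, so P ≅ (N₁ ⊕ N₂)/{(f₁ m , - f₂ m)}.
  IsPushout : ∀ {c} (M N₁ N₂ P : LeftModule R c c)
      (f₁ : LeftModule.Carrierᴹ M → LeftModule.Carrierᴹ N₁)
      (f₂ : LeftModule.Carrierᴹ M → LeftModule.Carrierᴹ N₂)
      (g₁ : LeftModule.Carrierᴹ N₁ → LeftModule.Carrierᴹ P)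
      (g₂ : LeftModule.Carrierᴹ N₂ → LeftModule.Carrierᴹ P) → Set (r ⊔ c)
  IsPushout M N₁ N₂ P f₁ f₂ g₁ g₂ =
    IsHom N₁ P g₁ × IsHom N₂ P g₂ ×
    (∀ p → ∃ λ (ab : LeftModule.Carrierᴹ N₁ × LeftModule.Carrierᴹ N₂) →
        let (a , b) = ab in LeftModule._≈ᴹ_ P (LeftModule._+ᴹ_ P (g₁ a) (g₂ b)) p) ×
    (∀ a b → LeftModule._≈ᴹ_ P (LeftModule._+ᴹ_ P (g₁ a) (g₂ b)) (LeftModule.0ᴹ P)
             ⇔ (∃ λ x → LeftModule._≈ᴹ_ N₁ a (f₁ x) ×
                        LeftModule._≈ᴹ_ N₂ b (LeftModule.-ᴹ_ N₂ (f₂ x))))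

  module _ {c k : Level} (K : LeftModule R c c → Set k) where

    ClosedUnderIso : Set (r ⊔ ℓr ⊔ Level.suc c ⊔ k)
    ClosedUnderIso = ∀ M N f → IsIso M N f → K M → K N

    ClosedUnderFiniteSums : Set (r ⊔ ℓr ⊔ Level.suc c ⊔ k)
    ClosedUnderFiniteSums = ∀ M N → K M → K N → K (DP.leftModule M N)

    ClosedUnderPureSub : Set (r ⊔ ℓr ⊔ Level.suc c ⊔ k)
    ClosedUnderPureSub = ∀ M N f → IsPureEmbedding M N f → K N → K M

    ClosedUnderPushoutsOfPureEmb : Set (r ⊔ ℓr ⊔ Level.suc c ⊔ k)
    ClosedUnderPushoutsOfPureEmb = ∀ M N₁ N₂ P f₁ f₂ g₁ g₂ →
      K M → K N₁ → K N₂ →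
      IsPureEmbedding M N₁ f₁ → IsPureEmbedding M N₂ f₂ →
      IsPushout M N₁ N₂ P f₁ f₂ g₁ g₂ → K P

    ClosedUnderPureEpiImages : Set (r ⊔ ℓr ⊔ Level.suc c ⊔ k)
    ClosedUnderPureEpiImages = ∀ M N f → IsPureEpi M N f → K M → K N

-- If f : M → N is a pure epimorphism with kernel L, then M ⊕ N, with the maps
-- m ↦ (m , 0) and m ↦ (m , f m), is the pushout of the pure embedding L ↪ M along
-- itself, and N is a direct summand, hence a pure submodule, of M ⊕ N.
-- Conversely, the pushout P of f₁ : M → N₁ and f₂ : M → N₂ is the image of
-- N₁ ⊕ N₂ under (a , b) ↦ g₁ a + g₂ b, whose kernel is the image of
-- e : m ↦ (f₁ m , - f₂ m). Since the first projection of e is the pure embedding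
-- f₁, pp-formulas satisfied by a tuple of the kernel can be pulled back to M and
-- pushed forward along e, so the kernel is pure and P is a pure epimorphic image
-- of N₁ ⊕ N₂.
module Submission where

open import Defs
open import Level using (Level; _⊔_)
open import Function.Bundles using (_⇔_; mk⇔; Equivalence)
open import Algebra.Bundles using (Ring; AbelianGroup)
open import Algebra.Module.Bundles using (LeftModule)

open import Data.Nat using (zero; suc)
open import Data.Fin using (Fin; zero; suc)
open import Data.Product using (Σ; ∃; _×_; _,_; proj₁; proj₂; <_,_>)
open import Function using (id; const; _∘_)
import Algebra.Module.Construct.DirectProduct as DP
open import Algebra.Module.Bundles.Raw using (RawLeftModule)
open import Algebra.Module.Morphism.Structures using (module LeftModuleMorphisms)
import Algebra.Module.Morphism.LeftModuleMonomorphism as Monomorphism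
import Algebra.Module.Morphism.Construct.Identity as Identity
import Algebra.Module.Morphism.Construct.Composition as Composition
import Algebra.Properties.Group as GroupProperties
import Algebra.Properties.AbelianGroup as AbelianGroupProperties
import Algebra.Properties.CommutativeSemigroup as CommutativeSemigroupProperties
import Relation.Binary.Reasoning.Setoid as SetoidReasoning

open LeftModuleMorphisms using (IsLeftModuleHomomorphism; IsLeftModuleMonomorphism)

module _ {r ℓr : Level} {R : Ring r ℓr} where
  private module R = Ring R

  module _ {m ℓm} (M : LeftModule R m ℓm) where
    open LeftModule M

    Σᴹ-cong : ∀ {n} {x y : Fin n → Carrierᴹ} → (∀ j → x j ≈ᴹ y j) → Σᴹ M x ≈ᴹ Σᴹ M y
    Σᴹ-cong {zero}  x≈y = ≈ᴹ-refl
    Σᴹ-cong {suc n} x≈y = +ᴹ-cong (x≈y zero) (Σᴹ-cong (x≈y ∘ suc))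

    lin-cong : ∀ {n} (a : Fin n → R.Carrier) {x y : Fin n → Carrierᴹ} →
               (∀ j → x j ≈ᴹ y j) → lin M a x ≈ᴹ lin M a y
    lin-cong a x≈y = Σᴹ-cong (λ j → *ₗ-congˡ (x≈y j))

    row : ∀ {n} (φ : PP {R = R} n) → Fin (PP.k φ) →
          (Fin n → Carrierᴹ) → (Fin (PP.m φ) → Carrierᴹ) → Carrierᴹ
    row φ i x y = lin M (PP.A φ i) x +ᴹ lin M (PP.B φ i) y

    Solves : ∀ {n} (φ : PP {R = R} n) → (Fin n → Carrierᴹ) → (Fin (PP.m φ) → Carrierᴹ) → Set ℓm
    Solves φ x y = ∀ i → row φ i x y ≈ᴹ 0ᴹ

    Solves-cong : ∀ {n} (φ : PP n) {x x' y y'} → (∀ j → x j ≈ᴹ x' j) → (∀ l → y l ≈ᴹ y' l) →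
                  Solves φ x y → Solves φ x' y'
    Solves-cong φ x≈x' y≈y' sol i =
      ≈ᴹ-trans (+ᴹ-cong (lin-cong (PP.A φ i) (λ j → ≈ᴹ-sym (x≈x' j)))
                        (lin-cong (PP.B φ i) (λ l → ≈ᴹ-sym (y≈y' l))))
               (sol i)

    Sat-cong : ∀ {n} (φ : PP n) {x x'} → (∀ j → x j ≈ᴹ x' j) → Sat M φ x → Sat M φ x'
    Sat-cong φ x≈x' (y , sol) = y , Solves-cong φ x≈x' (λ _ → ≈ᴹ-refl) sol

    SatIn-cong : ∀ {p} (S : Carrierᴹ → Set p) {n} (φ : PP n) {x x'} →
                 (∀ j → x j ≈ᴹ x' j) → SatIn M S φ x → SatIn M S φ x'
    SatIn-cong S φ x≈x' (y , y∈S , sol) = y , y∈S , Solves-cong φ x≈x' (λ _ → ≈ᴹ-refl) sol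

    SatIn⇒Sat : ∀ {p} (S : Carrierᴹ → Set p) {n} (φ : PP n) {x} → SatIn M S φ x → Sat M φ x
    SatIn⇒Sat S φ (y , _ , sol) = y , sol

    IsPureSubset-resp : ∀ {p q} {S : Carrierᴹ → Set p} {T : Carrierᴹ → Set q} →
                        (∀ x → S x → T x) → (∀ x → T x → S x) →
                        IsPureSubset M S → IsPureSubset M T
    IsPureSubset-resp {T = T} S⊆T T⊆S S-pure φ x x∈T = mk⇔ (SatIn⇒Sat T φ) λ sat →
      let (y , y∈S , sol) = Equivalence.from (S-pure φ x (λ j → T⊆S (x j) (x∈T j))) sat
      in y , (λ l → S⊆T (y l) (y∈S l)) , sol

  module _ {m₁ ℓ₁ m₂ ℓ₂} (M : LeftModule R m₁ ℓ₁) (N : LeftModule R m₂ ℓ₂) where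
    private
      module M = LeftModule M
      module N = LeftModule N

    mkIsHom : (g : M.Carrierᴹ → N.Carrierᴹ) →
              (∀ {x y} → x M.≈ᴹ y → g x N.≈ᴹ g y) →
              (∀ x y → g (x M.+ᴹ y) N.≈ᴹ g x N.+ᴹ g y) →
              (∀ a x → g (a M.*ₗ x) N.≈ᴹ a N.*ₗ g x) →
              IsHom M N g
    mkIsHom g cong +-homo *-homo = record
      { +ᴹ-isGroupHomomorphism = record
        { isMonoidHomomorphism = record
          { isMagmaHomomorphism = record
            { isRelHomomorphism = record { cong = cong }
            ; homo = +-homo }
          ; ε-homo = 0-homo }
        ; ⁻¹-homo = λ x → GroupProperties.inverseˡ-unique N.+ᴹ-group (g (M.-ᴹ x)) (g x)
            (N.≈ᴹ-trans (N.≈ᴹ-sym (+-homo _ _)) (N.≈ᴹ-trans (cong (M.-ᴹ‿inverseˡ x)) 0-homo)) }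
      ; *ₗ-homo = *-homo }
      where
        0-homo : g M.0ᴹ N.≈ᴹ N.0ᴹ
        0-homo = N.≈ᴹ-trans (cong (M.≈ᴹ-sym (M.*ₗ-zeroˡ M.0ᴹ)))
                            (N.≈ᴹ-trans (*-homo R.0# M.0ᴹ) (N.*ₗ-zeroˡ _))

    const-0-isHom : IsHom M N (const N.0ᴹ)
    const-0-isHom = mkIsHom (const N.0ᴹ) (λ _ → N.≈ᴹ-refl)
      (λ _ _ → N.≈ᴹ-sym (N.+ᴹ-identityˡ N.0ᴹ)) (λ a _ → N.≈ᴹ-sym (N.*ₗ-zeroʳ a))

    module _ {g : M.Carrierᴹ → N.Carrierᴹ} (g-hom : IsHom M N g) where
      private module g = IsLeftModuleHomomorphism g-hom

      Σᴹ-homo : ∀ {n} (x : Fin n → M.Carrierᴹ) → g (Σᴹ M x) N.≈ᴹ Σᴹ N (g ∘ x)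
      Σᴹ-homo {zero}  x = g.0ᴹ-homo
      Σᴹ-homo {suc n} x = N.≈ᴹ-trans (g.+ᴹ-homo _ _) (N.+ᴹ-congˡ (Σᴹ-homo (x ∘ suc)))

      lin-homo : ∀ {n} (a : Fin n → R.Carrier) (x : Fin n → M.Carrierᴹ) →
                 g (lin M a x) N.≈ᴹ lin N a (g ∘ x)
      lin-homo a x =
        N.≈ᴹ-trans (Σᴹ-homo (λ j → a j M.*ₗ x j)) (Σᴹ-cong N (λ j → g.*ₗ-homo (a j) (x j)))

      row-homo : ∀ {n} (φ : PP n) i x y → g (row M {n} φ i x y) N.≈ᴹ row N φ i (g ∘ x) (g ∘ y)
      row-homo φ i x y =
        N.≈ᴹ-trans (g.+ᴹ-homo _ _) (N.+ᴹ-cong (lin-homo (PP.A φ i) x) (lin-homo (PP.B φ i) y))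

      Solves-homo : ∀ {n} (φ : PP n) {x y} → Solves M φ x y → Solves N φ (g ∘ x) (g ∘ y)
      Solves-homo φ {x} {y} sol i = begin
        row N φ i (g ∘ x) (g ∘ y) ≈⟨ row-homo φ i x y ⟨
        g (row M φ i x y)         ≈⟨ g.⟦⟧-cong (sol i) ⟩
        g M.0ᴹ                    ≈⟨ g.0ᴹ-homo ⟩
        N.0ᴹ                      ∎
        where open SetoidReasoning N.≈ᴹ-setoid

      Sat-homo : ∀ {n} (φ : PP n) {x} → Sat M φ x → SatIn N (Image M N g) φ (g ∘ x)
      Sat-homo φ (y , sol) = g ∘ y , (λ l → y l , N.≈ᴹ-refl) , Solves-homo φ sol

    ReflectsPP : (M.Carrierᴹ → N.Carrierᴹ) → Set (r ⊔ m₁ ⊔ ℓ₁ ⊔ m₂ ⊔ ℓ₂)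
    ReflectsPP f = ∀ {n} (φ : PP n) x → Sat N φ (f ∘ x) → Sat M φ x

    IsPureEmbedding⇒ReflectsPP : ∀ {f} → IsPureEmbedding M N f → ReflectsPP f
    IsPureEmbedding⇒ReflectsPP {f} (f-hom , f-inj , f-pure) φ x sat = w , solves
      where
        module f = IsLeftModuleHomomorphism f-hom
        pulled : SatIn N (Image M N f) φ (f ∘ x)
        pulled = Equivalence.from (f-pure φ (f ∘ x) (λ j → x j , N.≈ᴹ-refl)) sat
        w : Fin (PP.m φ) → M.Carrierᴹ
        w l = proj₁ (proj₁ (proj₂ pulled) l)
        fw≈y : ∀ l → f (w l) N.≈ᴹ proj₁ pulled l
        fw≈y l = proj₂ (proj₁ (proj₂ pulled) l)
        solves : Solves M φ x w
        solves i = f-inj (N.≈ᴹ-trans (row-homo f-hom φ i x w)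
          (N.≈ᴹ-trans (Solves-cong N φ (λ _ → N.≈ᴹ-refl) (λ l → N.≈ᴹ-sym (fw≈y l)) (proj₂ (proj₂ pulled)) i)
                      (N.≈ᴹ-sym f.0ᴹ-homo)))

  module _ {m₁ ℓ₁ m₂ ℓ₂ m₃ ℓ₃}
           {M : LeftModule R m₁ ℓ₁} {S : LeftModule R m₂ ℓ₂} {N : LeftModule R m₃ ℓ₃}
           {e : LeftModule.Carrierᴹ M → LeftModule.Carrierᴹ S}
           {p : LeftModule.Carrierᴹ S → LeftModule.Carrierᴹ N}
           {f : LeftModule.Carrierᴹ M → LeftModule.Carrierᴹ N} where
    private
      module S = LeftModule S
      module N = LeftModule N

    ReflectsPP-factor⇒Image-pure : IsHom M S e → IsHom S N p → ReflectsPP M N f →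
                                   (∀ x → p (e x) N.≈ᴹ f x) → IsPureSubset S (Image M S e)
    ReflectsPP-factor⇒Image-pure e-hom p-hom f-reflects p∘e≈f φ x x∈Im =
      mk⇔ (SatIn⇒Sat S (Image M S e) φ) pull-push
      where
        module p = IsLeftModuleHomomorphism p-hom
        preimage : Fin _ → LeftModule.Carrierᴹ M
        preimage j = proj₁ (x∈Im j)
        px≈f-preimage : ∀ j → p (x j) N.≈ᴹ f (preimage j)
        px≈f-preimage j = N.≈ᴹ-trans (p.⟦⟧-cong (S.≈ᴹ-sym (proj₂ (x∈Im j)))) (p∘e≈f (preimage j))
        pull-push : Sat S φ x → SatIn S (Image M S e) φ x
        pull-push sat =
          SatIn-cong S (Image M S e) φ (λ j → proj₂ (x∈Im j))
            (Sat-homo M S e-hom φ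
              (f-reflects φ preimage
                (Sat-cong N φ px≈f-preimage
                  (SatIn⇒Sat N (Image S N p) φ (Sat-homo S N p-hom φ sat)))))

  module _ {m ℓm} (M : LeftModule R m ℓm) where
    private module M = LeftModule M

    id-isHom : IsHom M M id
    id-isHom = Identity.isLeftModuleHomomorphism M.rawLeftModule M.≈ᴹ-refl

    -ᴹ-isHom : IsHom M M M.-ᴹ_
    -ᴹ-isHom = mkIsHom M M M.-ᴹ_ M.-ᴹ‿cong
      (λ x y → M.≈ᴹ-sym (AbelianGroupProperties.⁻¹-∙-comm M.+ᴹ-abelianGroup x y))
      (λ a x → M.≈ᴹ-sym (GroupProperties.inverseˡ-unique M.+ᴹ-group (a M.*ₗ (M.-ᴹ x)) (a M.*ₗ x)
        (M.≈ᴹ-trans (M.≈ᴹ-sym (M.*ₗ-distribˡ a _ _))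
          (M.≈ᴹ-trans (M.*ₗ-congˡ (M.-ᴹ‿inverseˡ x)) (M.*ₗ-zeroʳ a)))))

  module _ {m₁ ℓ₁ m₂ ℓ₂} (M : LeftModule R m₁ ℓ₁) (N : LeftModule R m₂ ℓ₂) where
    private
      module M = LeftModule M
      module N = LeftModule N
      M⊕N = DP.leftModule M N

    proj₁-isHom : IsHom M⊕N M proj₁
    proj₁-isHom = mkIsHom M⊕N M proj₁ proj₁ (λ _ _ → M.≈ᴹ-refl) (λ _ _ → M.≈ᴹ-refl)

    proj₂-isHom : IsHom M⊕N N proj₂
    proj₂-isHom = mkIsHom M⊕N N proj₂ proj₂ (λ _ _ → N.≈ᴹ-refl) (λ _ _ → N.≈ᴹ-refl)

    <,>-isHom : ∀ {m ℓ} {L : LeftModule R m ℓ} {g h} → IsHom L M g → IsHom L N h → IsHom L M⊕N < g , h >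
    <,>-isHom {L = L} g-hom h-hom = mkIsHom L M⊕N _
      (λ x≈y → g.⟦⟧-cong x≈y , h.⟦⟧-cong x≈y)
      (λ x y → g.+ᴹ-homo x y , h.+ᴹ-homo x y)
      (λ a x → g.*ₗ-homo a x , h.*ₗ-homo a x)
      where
        module g = IsLeftModuleHomomorphism g-hom
        module h = IsLeftModuleHomomorphism h-hom

    copair : ∀ {m ℓ} (P : LeftModule R m ℓ) →
             (M.Carrierᴹ → LeftModule.Carrierᴹ P) → (N.Carrierᴹ → LeftModule.Carrierᴹ P) →
             M.Carrierᴹ × N.Carrierᴹ → LeftModule.Carrierᴹ P
    copair P g h ab = LeftModule._+ᴹ_ P (g (proj₁ ab)) (h (proj₂ ab))

    copair-isHom : ∀ {m ℓ} {P : LeftModule R m ℓ} {g h} → IsHom M P g → IsHom N P h →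
                   IsHom M⊕N P (copair P g h)
    copair-isHom {P = P} {g} {h} g-hom h-hom = mkIsHom M⊕N P _
      (λ (a≈a' , b≈b') → P.+ᴹ-cong (g.⟦⟧-cong a≈a') (h.⟦⟧-cong b≈b'))
      (λ (a , b) (a' , b') → P.≈ᴹ-trans (P.+ᴹ-cong (g.+ᴹ-homo a a') (h.+ᴹ-homo b b'))
                                         (interchange (g a) (g a') (h b) (h b')))
      (λ s (a , b) → P.≈ᴹ-trans (P.+ᴹ-cong (g.*ₗ-homo s a) (h.*ₗ-homo s b))
                                 (P.≈ᴹ-sym (P.*ₗ-distribˡ s (g a) (h b))))
      where
        module P = LeftModule P
        module g = IsLeftModuleHomomorphism g-hom
        module h = IsLeftModuleHomomorphism h-hom
        open CommutativeSemigroupProperties (AbelianGroup.commutativeSemigroup P.+ᴹ-abelianGroup) using (interchange)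

    inj₂-isPureEmbedding : IsPureEmbedding N M⊕N < const M.0ᴹ , id >
    inj₂-isPureEmbedding =
        inj₂-isHom
      , proj₂
      , ReflectsPP-factor⇒Image-pure {M = N} {M⊕N} {N} {f = id}
          inj₂-isHom proj₂-isHom (λ _ _ sat → sat) (λ _ → N.≈ᴹ-refl)
      where
        inj₂-isHom : IsHom N M⊕N < const M.0ᴹ , id >
        inj₂-isHom = <,>-isHom {L = N} (const-0-isHom N M) (id-isHom N)

  module KernelSubmodule {m₁ ℓ₁ m₂ ℓ₂} (M : LeftModule R m₁ ℓ₁) (N : LeftModule R m₂ ℓ₂)
                         {f : LeftModule.Carrierᴹ M → LeftModule.Carrierᴹ N} (f-hom : IsHom M N f) where
    private
      module M = LeftModule M
      module N = LeftModule N
      module f = IsLeftModuleHomomorphism f-hom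
      open SetoidReasoning N.≈ᴹ-setoid

    ker : M.Carrierᴹ → Set ℓ₂
    ker = Kernel M N f

    ker-resp : ∀ {x y} → x M.≈ᴹ y → ker x → ker y
    ker-resp x≈y fx≈0 = N.≈ᴹ-trans (f.⟦⟧-cong (M.≈ᴹ-sym x≈y)) fx≈0

    ker-0ᴹ : ker M.0ᴹ
    ker-0ᴹ = f.0ᴹ-homo

    ker-+ᴹ : ∀ {x y} → ker x → ker y → ker (x M.+ᴹ y)
    ker-+ᴹ {x} {y} fx≈0 fy≈0 = begin
      f (x M.+ᴹ y)       ≈⟨ f.+ᴹ-homo x y ⟩
      f x N.+ᴹ f y       ≈⟨ N.+ᴹ-cong fx≈0 fy≈0 ⟩
      N.0ᴹ N.+ᴹ N.0ᴹ     ≈⟨ N.+ᴹ-identityˡ N.0ᴹ ⟩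
      N.0ᴹ               ∎

    ker-*ₗ : ∀ a {x} → ker x → ker (a M.*ₗ x)
    ker-*ₗ a {x} fx≈0 = begin
      f (a M.*ₗ x)       ≈⟨ f.*ₗ-homo a x ⟩
      a N.*ₗ f x         ≈⟨ N.*ₗ-congˡ fx≈0 ⟩
      a N.*ₗ N.0ᴹ        ≈⟨ N.*ₗ-zeroʳ a ⟩
      N.0ᴹ               ∎

    ker--ᴹ : ∀ {x} → ker x → ker (M.-ᴹ x)
    ker--ᴹ {x} fx≈0 = begin
      f (M.-ᴹ x)         ≈⟨ f.-ᴹ-homo x ⟩
      N.-ᴹ f x           ≈⟨ N.-ᴹ‿cong fx≈0 ⟩
      N.-ᴹ N.0ᴹ          ≈⟨ GroupProperties.ε⁻¹≈ε N.+ᴹ-group ⟩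
      N.0ᴹ               ∎

    private
      rawKer : RawLeftModule R.Carrier (m₁ ⊔ ℓ₂) ℓ₁
      rawKer = record
        { Carrierᴹ = Σ M.Carrierᴹ ker
        ; _≈ᴹ_     = λ (x , _) (y , _) → x M.≈ᴹ y
        ; _+ᴹ_     = λ (x , x∈ker) (y , y∈ker) → x M.+ᴹ y , ker-+ᴹ x∈ker y∈ker
        ; _*ₗ_     = λ a (x , x∈ker) → a M.*ₗ x , ker-*ₗ a x∈ker
        ; 0ᴹ       = M.0ᴹ , ker-0ᴹ
        ; -ᴹ_      = λ (x , x∈ker) → M.-ᴹ x , ker--ᴹ x∈ker
        }

      proj₁-isMonomorphism : IsLeftModuleMonomorphism rawKer M.rawLeftModule proj₁
      proj₁-isMonomorphism = record
        { isLeftModuleHomomorphism = record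
          { +ᴹ-isGroupHomomorphism = record
            { isMonoidHomomorphism = record
              { isMagmaHomomorphism = record
                { isRelHomomorphism = record { cong = id }
                ; homo = λ _ _ → M.≈ᴹ-refl }
              ; ε-homo = M.≈ᴹ-refl }
            ; ⁻¹-homo = λ _ → M.≈ᴹ-refl }
          ; *ₗ-homo = λ _ _ → M.≈ᴹ-refl }
        ; injective = id }

    Ker : LeftModule R (m₁ ⊔ ℓ₂) ℓ₁
    Ker = record
      { RawLeftModule rawKer
      ; isLeftModule = Monomorphism.isLeftModule proj₁-isMonomorphism (Ring.isRing R) M.isLeftModule }

    proj₁-isPureEmbedding : IsPureSubset M ker → IsPureEmbedding Ker M proj₁
    proj₁-isPureEmbedding ker-pure =
        IsLeftModuleMonomorphism.isLeftModuleHomomorphism proj₁-isMonomorphism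
      , id
      , IsPureSubset-resp M (λ x x∈ker → (x , x∈ker) , M.≈ᴹ-refl)
                            (λ _ ((_ , y∈ker) , y≈x) → ker-resp y≈x y∈ker) ker-pure

  module _ {c} (M N : LeftModule R c c) {f : LeftModule.Carrierᴹ M → LeftModule.Carrierᴹ N}
           (f-hom : IsHom M N f) where
    private
      module M = LeftModule M
      module N = LeftModule N
      module MG = GroupProperties M.+ᴹ-group
    open KernelSubmodule M N f-hom

    Ker-selfPushout : (∀ y → Image M N f y) →
      IsPushout Ker M M (DP.leftModule M N) proj₁ proj₁ < id , const N.0ᴹ > < id , f >
    Ker-selfPushout f-surj =
        <,>-isHom M N {L = M} (id-isHom M) (const-0-isHom M N)
      , <,>-isHom M N {L = M} (id-isHom M) f-hom
      , (λ (p , q) → let (b , fb≈q) = f-surj q in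
           (p M.+ᴹ M.-ᴹ b , b) , MG.//-rightDividesˡ b p , N.≈ᴹ-trans (N.+ᴹ-identityˡ (f b)) fb≈q)
      , λ a b → mk⇔ (kernel⇒antidiagonal a b) (antidiagonal⇒kernel a b)
      where
        InKernel : M.Carrierᴹ → M.Carrierᴹ → Set c
        InKernel a b = (a M.+ᴹ b M.≈ᴹ M.0ᴹ) × (N.0ᴹ N.+ᴹ f b N.≈ᴹ N.0ᴹ)
        Antidiagonal : M.Carrierᴹ → M.Carrierᴹ → Set c
        Antidiagonal a b = ∃ λ ((x , _) : Σ M.Carrierᴹ ker) → (a M.≈ᴹ x) × (b M.≈ᴹ M.-ᴹ x)
        kernel⇒antidiagonal : ∀ a b → InKernel a b → Antidiagonal a b
        kernel⇒antidiagonal a b (a+b≈0 , fb≈0) =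
          (a , ker-resp (M.≈ᴹ-sym (MG.inverseˡ-unique a b a+b≈0)) (ker--ᴹ b∈ker))
          , M.≈ᴹ-refl , MG.inverseʳ-unique a b a+b≈0
          where
            b∈ker : ker b
            b∈ker = N.≈ᴹ-trans (N.≈ᴹ-sym (N.+ᴹ-identityˡ (f b))) fb≈0
        antidiagonal⇒kernel : ∀ a b → Antidiagonal a b → InKernel a b
        antidiagonal⇒kernel a b ((x , x∈ker) , a≈x , b≈-x) =
            M.≈ᴹ-trans (M.+ᴹ-cong a≈x b≈-x) (M.-ᴹ‿inverseʳ x)
          , N.≈ᴹ-trans (N.+ᴹ-identityˡ (f b)) (ker-resp (M.≈ᴹ-sym b≈-x) (ker--ᴹ x∈ker))

  module _ {c} (M N₁ N₂ P : LeftModule R c c)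
           {f₁ : LeftModule.Carrierᴹ M → LeftModule.Carrierᴹ N₁}
           {f₂ : LeftModule.Carrierᴹ M → LeftModule.Carrierᴹ N₂}
           {g₁ : LeftModule.Carrierᴹ N₁ → LeftModule.Carrierᴹ P}
           {g₂ : LeftModule.Carrierᴹ N₂ → LeftModule.Carrierᴹ P} where
    private
      module N₁ = LeftModule N₁
      module N₂ = LeftModule N₂
      module P = LeftModule P

    pushout-copair-isPureEpi : IsPureEmbedding M N₁ f₁ → IsHom M N₂ f₂ →
                               IsPushout M N₁ N₂ P f₁ f₂ g₁ g₂ →
                               IsPureEpi (DP.leftModule N₁ N₂) P (copair N₁ N₂ P g₁ g₂)
    pushout-copair-isPureEpi f₁-pure f₂-hom (g₁-hom , g₂-hom , surjective , kernel) =
        copair-isHom N₁ N₂ {P = P} g₁-hom g₂-hom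
      , surjective
      , IsPureSubset-resp N₁⊕N₂ image⇒kernel kernel⇒image
          (ReflectsPP-factor⇒Image-pure e-hom (proj₁-isHom N₁ N₂)
             (IsPureEmbedding⇒ReflectsPP M N₁ f₁-pure) (λ _ → N₁.≈ᴹ-refl))
      where
        N₁⊕N₂ = DP.leftModule N₁ N₂
        e : LeftModule.Carrierᴹ M → N₁.Carrierᴹ × N₂.Carrierᴹ
        e = < f₁ , N₂.-ᴹ_ ∘ f₂ >
        e-hom : IsHom M N₁⊕N₂ e
        e-hom = <,>-isHom N₁ N₂ {L = M} (proj₁ f₁-pure)
                  (Composition.isLeftModuleHomomorphism N₂.≈ᴹ-trans f₂-hom (-ᴹ-isHom N₂))
        h : N₁.Carrierᴹ × N₂.Carrierᴹ → P.Carrierᴹ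
        h = copair N₁ N₂ P g₁ g₂
        image⇒kernel : ∀ ab → Image M N₁⊕N₂ e ab → Kernel N₁⊕N₂ P h ab
        image⇒kernel (a , b) (x , f₁x≈a , -f₂x≈b) =
          Equivalence.from (kernel a b) (x , N₁.≈ᴹ-sym f₁x≈a , N₂.≈ᴹ-sym -f₂x≈b)
        kernel⇒image : ∀ ab → Kernel N₁⊕N₂ P h ab → Image M N₁⊕N₂ e ab
        kernel⇒image (a , b) ab∈ker =
          let (x , a≈f₁x , b≈-f₂x) = Equivalence.to (kernel a b) ab∈ker
          in x , N₁.≈ᴹ-sym a≈f₁x , N₂.≈ᴹ-sym b≈-f₂x

  module _ {c k} (K : LeftModule R c c → Set k) where

    ClosedUnderPushoutsOfPureEmb⇒ClosedUnderPureEpiImages :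
      ClosedUnderPureSub K → ClosedUnderPushoutsOfPureEmb K → ClosedUnderPureEpiImages K
    ClosedUnderPushoutsOfPureEmb⇒ClosedUnderPureEpiImages pure-sub pushouts
      M N f (f-hom , f-surj , ker-pure) M∈K =
        pure-sub N M⊕N _ (inj₂-isPureEmbedding M N) M⊕N∈K
      where
        open KernelSubmodule M N f-hom using (Ker; proj₁-isPureEmbedding)
        M⊕N = DP.leftModule M N
        ι-pure = proj₁-isPureEmbedding ker-pure
        M⊕N∈K : K M⊕N
        M⊕N∈K = pushouts Ker M M M⊕N _ _ _ _ (pure-sub Ker M _ ι-pure M∈K) M∈K M∈K ι-pure ι-pure
                         (Ker-selfPushout M N f-hom f-surj)

    ClosedUnderPureEpiImages⇒ClosedUnderPushoutsOfPureEmb :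
      ClosedUnderFiniteSums K → ClosedUnderPureEpiImages K → ClosedUnderPushoutsOfPureEmb K
    ClosedUnderPureEpiImages⇒ClosedUnderPushoutsOfPureEmb sums epi-images
      M N₁ N₂ P f₁ f₂ g₁ g₂ _ N₁∈K N₂∈K f₁-pure f₂-pure pushout =
        epi-images (DP.leftModule N₁ N₂) P _
          (pushout-copair-isPureEpi M N₁ N₂ P f₁-pure (proj₁ f₂-pure) pushout)
          (sums N₁ N₂ N₁∈K N₂∈K)

lemma4p7 : {r ℓr c k : Level} (R : Ring r ℓr) (K : LeftModule R c c → Set k) →
    ClosedUnderFiniteSums K → ClosedUnderPureSub K → ClosedUnderIso K →
    (ClosedUnderPushoutsOfPureEmb K ⇔ ClosedUnderPureEpiImages K)
lemma4p7 R K sums pure-sub _ = mk⇔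
  (ClosedUnderPushoutsOfPureEmb⇒ClosedUnderPureEpiImages K pure-sub)
  (ClosedUnderPureEpiImages⇒ClosedUnderPushoutsOfPureEmb K sums)
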